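{- Let $G=(V,E)$ be a DAG and $B\ge 0$ an integer. There is an optimal solution $N$ of the MCI instance $(G,B)$ such that $G(N)$ contains at most one strongly connected component with more than one vertex.
   Context: For a directed graph $G=(V,E)$ let $f(G)$ be the number of ordered pairs $(v,u)\in V\times V$ such that there is a directed path from $v$ to $u$ in $G$ (each vertex reaches itself). For a set $N$ of ordered pairs, $G(N)=(V,E\cup N)$. MCI instance $(G,B)$: a solution is $N\subseteq (V\times V)\setminus E$ with $|N|\le B$, and it is optimal if it maximizes $f(G(N))$. -}

module Defs where

open import Data.Nat using (ℕ; _≤_)
open import Data.Fin using (Fin)
open import Data.Product using (_×_; _,_; Σ; ∃; ∃-syntax)
open import Data.List using (List; length; _++_)
open import Data.List.Membership.Propositional using (_∈_; _∉_)
open import Data.List.Relation.Unary.Unique.Propositional using (Unique)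
open import Data.List.Relation.Unary.All using (All)
open import Relation.Binary.Construct.Closure.ReflexiveTransitive using (Star)
open import Relation.Binary.PropositionalEquality using (_≡_)
open import Relation.Nullary using (¬_)
open import Function.Bundles using (_⇔_)

-- A directed graph on vertex set V = Fin n, with edge set given by a list of
-- ordered pairs (duplicates irrelevant: only membership matters).
Pair : ℕ → Set
Pair n = Fin n × Fin n

EdgeSet : ℕ → Set
EdgeSet n = List (Pair n)

Edge : ∀ {n} → EdgeSet n → Fin n → Fin n → Set
Edge E v u = (v , u) ∈ E

-- directed path from v to u (each vertex reaches itself via the empty path)
Reach : ∀ {n} → EdgeSet n → Fin n → Fin n → Set
Reach E = Star (Edge E)

IsDAG : ∀ {n} → EdgeSet n → Set
IsDAG E = ∀ v u → Edge E v u → ¬ Reach E u v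

-- f(G) = k : k is the number of ordered pairs (v,u) such that u is reachable
-- from v, i.e. the size of a duplicate-free enumeration of that set.
HasReachCount : ∀ {n} → EdgeSet n → ℕ → Set
HasReachCount {n} E k =
  Σ (List (Pair n)) λ L →
    Unique L × (∀ v u → ((v , u) ∈ L) ⇔ Reach E v u) × length L ≡ k

addEdges : ∀ {n} → EdgeSet n → EdgeSet n → EdgeSet n
addEdges E N = E ++ N

IsSolution : ∀ {n} → EdgeSet n → ℕ → EdgeSet n → Set
IsSolution E B N = Unique N × All (λ p → p ∉ E) N × length N ≤ B

IsOptimal : ∀ {n} → EdgeSet n → ℕ → EdgeSet n → Set
IsOptimal {n} E B N =
  IsSolution E B N ×
  ∃[ k ] (HasReachCount (addEdges E N) k ×
          (∀ (N' : EdgeSet n) k' → IsSolution E B N' →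
             HasReachCount (addEdges E N') k' → k' ≤ k))

SameSCC : ∀ {n} → EdgeSet n → Fin n → Fin n → Set
SameSCC E v u = Reach E v u × Reach E u v

InNontrivialSCC : ∀ {n} → EdgeSet n → Fin n → Set
InNontrivialSCC E v = ∃[ w ] (¬ (w ≡ v) × SameSCC E v w)

AtMostOneNontrivialSCC : ∀ {n} → EdgeSet n → Set
AtMostOneNontrivialSCC E =
  ∀ v u → InNontrivialSCC E v → InNontrivialSCC E u → SameSCC E v u

-- Idea (an exchange argument).  Optimal solutions exist because there are
-- only finitely many canonical candidates (duplicate-free sublists of all
-- pairs).  Let N be optimal and suppose G = E ∪ N has two different
-- nontrivial SCCs C₁ ∋ v and C₂ ∋ u.  Since E is acyclic, every cycle of G
-- uses an added edge, so C₁ contains an added edge x₁→y₁ and C₂ an added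
-- edge x₂→y₂.  Replace these two edges by x₁→y₂ and x₂→y₁.  The closing paths
-- y₁ ⇝ x₁ and y₂ ⇝ x₂ of G avoid both removed edges (a path inside one SCC
-- never visits the other), so every old edge xᵢ→yᵢ is still simulated by a
-- path, hence nothing reachable is lost; but now v and u reach each other,
-- which G did not allow.  The new solution therefore reaches strictly more
-- pairs, contradicting optimality.  So EVERY optimal solution qualifies.

module Submission where

open import Defs
open import Data.Nat using (ℕ; _≤_; _<_; _≤?_; z≤n; s≤s)
open import Data.Nat.Properties using (≤-trans; n≮n)
open import Data.Fin using (Fin; _≟_)
open import Data.Product using (_×_; _,_; ∃-syntax; proj₁; proj₂; swap)
open import Data.Product.Properties using (≡-dec)
open import Data.Sum using (_⊎_; inj₁; inj₂)
open import Data.Empty using (⊥; ⊥-elim)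
open import Data.Bool using (true; false)
open import Data.List using (List; []; _∷_; length; _++_; filter; map; cartesianProduct; allFin)
open import Data.List.Properties using (filter-notAll)
open import Data.List.Extrema.Nat using (argmax; argmax-all; f[xs]≤f[argmax])
open import Data.List.Membership.Propositional using (_∈_)
open import Data.List.Membership.Propositional.Properties
  using (∈-++⁻; ∈-++⁺ˡ; ∈-++⁺ʳ; ∈-map⁺; ∈-filter⁺; ∈-filter⁻; ∈-cartesianProduct⁺; ∈-allFin)
open import Data.List.Relation.Unary.Any as Any using (here; there)
open import Data.List.Relation.Unary.All as All using (all?)
open import Data.List.Relation.Unary.AllPairs as AllPairs using (_∷_)
open import Data.List.Relation.Unary.Unique.Propositional using (Unique)
open import Data.List.Relation.Unary.Unique.Propositional.Properties using (filter⁺; cartesianProduct⁺; allFin⁺)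
open import Relation.Binary.Core using (_⇒_)
open import Relation.Binary.Definitions using (DecidableEquality)
open import Relation.Binary.Construct.Closure.ReflexiveTransitive as Star using (Star; ε; _◅_; _◅◅_; _⋆)
open import Relation.Binary.PropositionalEquality using (_≢_; refl; sym)
open import Relation.Nullary using (¬_; Dec; yes; no; ¬?; does)
open import Relation.Nullary.Decidable using (map′; _×-dec_; _⊎-dec_)
open import Relation.Unary using (Decidable)
open import Function using (_∘_)
open import Function.Bundles using (_⇔_; mk⇔; Equivalence)

module Removal {A : Set} (_≟ₐ_ : DecidableEquality A) where

  remove : A → List A → List A
  remove e = filter (λ x → ¬? (x ≟ₐ e))

  remove-keeps : ∀ {e x xs} → x ∈ xs → x ≢ e → x ∈ remove e xs
  remove-keeps {e} x∈xs x≢e = ∈-filter⁺ (λ x → ¬? (x ≟ₐ e)) x∈xs x≢e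

  remove-shrinks : ∀ {e xs} → e ∈ xs → length (remove e xs) < length xs
  remove-shrinks {e} {xs} e∈xs =
    filter-notAll (λ x → ¬? (x ≟ₐ e)) xs (Any.map (λ e≡x x≢e → x≢e (sym e≡x)) e∈xs)

  unique-⊆⇒length≤ : ∀ {xs ys} → Unique xs → (∀ {z} → z ∈ xs → z ∈ ys) →
    length xs ≤ length ys
  unique-⊆⇒length≤ {[]} _ _ = z≤n
  unique-⊆⇒length≤ {x ∷ xs} {ys} (x∉xs ∷ unique-xs) xs⊆ys =
    ≤-trans (s≤s (unique-⊆⇒length≤ unique-xs tail⊆)) (remove-shrinks (xs⊆ys (here refl)))
    where
    tail⊆ : ∀ {z} → z ∈ xs → z ∈ remove x ys
    tail⊆ z∈xs = remove-keeps (xs⊆ys (there z∈xs)) (λ z≡x → All.lookup x∉xs z∈xs (sym z≡x))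

module _ {A : Set} where

  sublists : List A → List (List A)
  sublists [] = [] ∷ []
  sublists (x ∷ xs) = map (x ∷_) (sublists xs) ++ sublists xs

  filter∈sublists : ∀ {P : A → Set} (P? : Decidable P) xs → filter P? xs ∈ sublists xs
  filter∈sublists P? [] = here refl
  filter∈sublists P? (x ∷ xs) with does (P? x)
  ... | true  = ∈-++⁺ˡ (∈-map⁺ (x ∷_) (filter∈sublists P? xs))
  ... | false = ∈-++⁺ʳ (map (x ∷_) (sublists xs)) (filter∈sublists P? xs)

module EdgeAvoidance {A : Set} (_≟ₐ_ : DecidableEquality A) where

  Without : (A → A → Set) → A × A → A → A → Set
  Without R e a b = R a b × (a , b) ≢ e

  avoid : ∀ {R : A → A → Set} x y {a b} → Star R a b →
    Star (Without R (x , y)) a b ⊎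
    (Star (Without R (x , y)) a x × Star (Without R (x , y)) y b)
  avoid x y ε = inj₁ ε
  avoid x y (_◅_ {a} {c} r p) with avoid x y p | ≡-dec _≟ₐ_ _≟ₐ_ (a , c) (x , y)
  ... | inj₁ q         | no ac≢xy = inj₁ ((r , ac≢xy) ◅ q)
  ... | inj₂ (q , q')  | no ac≢xy = inj₂ ((r , ac≢xy) ◅ q , q')
  ... | inj₁ q         | yes refl = inj₂ (ε , q)
  ... | inj₂ (_ , q')  | yes refl = inj₂ (ε , q')

  -- a path ending at x never needs an edge leaving x
  shortcut : ∀ {R : A → A → Set} x y {a} → Star R a x → Star (Without R (x , y)) a x
  shortcut x y p with avoid x y p
  ... | inj₁ q = q
  ... | inj₂ (q , _) = q

  closing-path : ∀ {R : A → A → Set} x y x' y' → Star R y x →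
    ¬ (Star R y x' × Star R y' x) →
    Star (Without (Without R (x , y)) (x' , y')) y x
  closing-path {R} x y x' y' p no-round-trip with avoid x' y' (shortcut x y p)
  ... | inj₁ q = q
  ... | inj₂ (q , q') = ⊥-elim (no-round-trip (forget q , forget q'))
    where
    forget : Star (Without (Without R (x , y)) (x' , y')) ⇒ Star R
    forget = Star.map (proj₁ ∘ proj₁)

module _ {n : ℕ} where

  _≟ₚ_ : DecidableEquality (Pair n)
  _≟ₚ_ = ≡-dec _≟_ _≟_

  open Removal _≟ₚ_
  open EdgeAvoidance (_≟_ {n})
  open import Data.List.Membership.DecPropositional _≟ₚ_ using (_∈?_)
  open import Data.List.Relation.Unary.Unique.DecPropositional _≟ₚ_ using (unique?)

  old-edge : ∀ {a b} (E : EdgeSet n) → Without (Edge ((a , b) ∷ E)) (a , b) ⇒ Edge E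
  old-edge E (here e≡ab , e≢ab) = ⊥-elim (e≢ab e≡ab)
  old-edge E (there e∈E , _) = e∈E

  reach-∷ : ∀ {a b} (E : EdgeSet n) {v u} → Reach ((a , b) ∷ E) v u →
    Reach E v u ⊎ (Reach E v a × Reach E b u)
  reach-∷ {a} {b} E p with avoid a b p
  ... | inj₁ q = inj₁ (Star.map (old-edge E) q)
  ... | inj₂ (q , q') = inj₂ (Star.map (old-edge E) q , Star.map (old-edge E) q')

  reach? : (E : EdgeSet n) → ∀ v u → Dec (Reach E v u)
  reach? [] v u with v ≟ u
  ... | yes refl = yes ε
  ... | no v≢u = no λ { ε → v≢u refl ; (() ◅ _) }
  reach? ((a , b) ∷ E) v u =
    map′ lift (reach-∷ E) (reach? E v u ⊎-dec (reach? E v a ×-dec reach? E b u))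
    where
    lift : Reach E v u ⊎ (Reach E v a × Reach E b u) → Reach ((a , b) ∷ E) v u
    lift (inj₁ p) = Star.map there p
    lift (inj₂ (p , q)) = Star.map there p ◅◅ here refl ◅ Star.map there q

  reach-++ : ∀ (E : EdgeSet n) {N a b} → Reach (E ++ N) a b →
    Reach E a b ⊎ ∃[ x ] ∃[ y ] ((x , y) ∈ N × Reach (E ++ N) a x × Reach (E ++ N) y b)
  reach-++ E ε = inj₁ ε
  reach-++ E (_◅_ {a} {c} e p) with ∈-++⁻ E e | reach-++ E p
  ... | inj₂ e∈N | _ = inj₂ (a , c , e∈N , ε , p)
  ... | inj₁ e∈E | inj₁ q = inj₁ (e∈E ◅ q)
  ... | inj₁ e∈E | inj₂ (x , y , xy∈N , c⇝x , y⇝b) = inj₂ (x , y , xy∈N , e ◅ c⇝x , y⇝b)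

  cycle-uses-added-edge : ∀ {E N : EdgeSet n} → IsDAG E → ∀ {v a} →
    Edge (E ++ N) v a → Reach (E ++ N) a v →
    ∃[ x ] ∃[ y ] ((x , y) ∈ N × Reach (E ++ N) v x × Reach (E ++ N) y v)
  cycle-uses-added-edge {E} dag {v} {a} e a⇝v with reach-++ E a⇝v
  ... | inj₂ (x , y , xy∈N , a⇝x , y⇝v) = x , y , xy∈N , e ◅ a⇝x , y⇝v
  ... | inj₁ a⇝ᴱv with ∈-++⁻ E e
  ...   | inj₁ e∈E = ⊥-elim (dag v a e∈E a⇝ᴱv)
  ...   | inj₂ e∈N = v , a , e∈N , ε , a⇝v

  scc-trans : ∀ {G : EdgeSet n} {a b c} → SameSCC G a b → SameSCC G b c → SameSCC G a c
  scc-trans (a⇝b , b⇝a) (b⇝c , c⇝b) = a⇝b ◅◅ b⇝c , c⇝b ◅◅ b⇝a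

  scc-sym : ∀ {G : EdgeSet n} {a b} → SameSCC G a b → SameSCC G b a
  scc-sym = swap

  nontrivial-SCC-has-added-edge : ∀ {E N : EdgeSet n} → IsDAG E → ∀ {v} →
    InNontrivialSCC (E ++ N) v →
    ∃[ x ] ∃[ y ] ((x , y) ∈ N × SameSCC (E ++ N) v x × SameSCC (E ++ N) v y)
  nontrivial-SCC-has-added-edge dag (w , w≢v , ε , _) = ⊥-elim (w≢v refl)
  nontrivial-SCC-has-added-edge {E} {N} dag (w , w≢v , e ◅ a⇝w , w⇝v)
    with cycle-uses-added-edge dag e (a⇝w ◅◅ w⇝v)
  ... | x , y , xy∈N , v⇝x , y⇝v =
    x , y , xy∈N , (v⇝x , xy ◅ y⇝v) , (v⇝x ◅◅ xy ◅ ε , y⇝v)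
    where
    xy : Edge (E ++ N) x y
    xy = ∈-++⁺ʳ E xy∈N

  allPairs : List (Pair n)
  allPairs = cartesianProduct (allFin n) (allFin n)

  allPairs-unique : Unique allPairs
  allPairs-unique = cartesianProduct⁺ (allFin⁺ n) (allFin⁺ n)

  ∈-allPairs : ∀ (p : Pair n) → p ∈ allPairs
  ∈-allPairs (v , u) = ∈-cartesianProduct⁺ (∈-allFin v) (∈-allFin u)

  reachable? : (E : EdgeSet n) → Decidable (λ (p : Pair n) → Reach E (proj₁ p) (proj₂ p))
  reachable? E (v , u) = reach? E v u

  reachCount : EdgeSet n → ℕ
  reachCount E = length (filter (reachable? E) allPairs)

  reachCount-correct : (E : EdgeSet n) → HasReachCount E (reachCount E)
  reachCount-correct E =
    filter (reachable? E) allPairs ,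
    filter⁺ (reachable? E) allPairs-unique ,
    (λ v u → mk⇔ (proj₂ ∘ ∈-filter⁻ (reachable? E) {xs = allPairs})
                 (∈-filter⁺ (reachable? E) (∈-allPairs (v , u)))) ,
    refl

  Enumerates : List (Pair n) → EdgeSet n → Set
  Enumerates L E = ∀ v u → (v , u) ∈ L ⇔ Reach E v u

  enumeration-⊆ : ∀ {E E' : EdgeSet n} {L L'} → Enumerates L E → Enumerates L' E' →
    Reach E ⇒ Reach E' → ∀ {p} → p ∈ L → p ∈ L'
  enumeration-⊆ L⇔ L'⇔ E⊆E' {a , b} p∈L =
    Equivalence.from (L'⇔ a b) (E⊆E' (Equivalence.to (L⇔ a b) p∈L))

  count-mono : ∀ {E E' : EdgeSet n} {k k'} → HasReachCount E k → HasReachCount E' k' →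
    Reach E ⇒ Reach E' → k ≤ k'
  count-mono (L , unique-L , L⇔ , refl) (L' , _ , L'⇔ , refl) E⊆E' =
    unique-⊆⇒length≤ unique-L (enumeration-⊆ L⇔ L'⇔ E⊆E')

  count-strict : ∀ {E E' : EdgeSet n} {k k'} → HasReachCount E k → HasReachCount E' k' →
    Reach E ⇒ Reach E' → ∀ {v u} → ¬ Reach E v u → Reach E' v u → k < k'
  count-strict (L , unique-L , L⇔ , refl) (L' , _ , L'⇔ , refl) E⊆E' {v} {u} ¬vu vu' =
    unique-⊆⇒length≤ (All.tabulate new≢old ∷ unique-L) into-L'
    where
    new≢old : ∀ {p} → p ∈ L → (v , u) ≢ p
    new≢old p∈L refl = ¬vu (Equivalence.to (L⇔ v u) p∈L)
    into-L' : ∀ {p} → p ∈ (v , u) ∷ L → p ∈ L'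
    into-L' (here refl) = Equivalence.from (L'⇔ v u) vu'
    into-L' (there p∈L) = enumeration-⊆ L⇔ L'⇔ E⊆E' p∈L

  spanned? : (E L : EdgeSet n) → Decidable (λ p → ¬ p ∈ E × p ∈ L)
  spanned? E L p = ¬? (p ∈? E) ×-dec p ∈? L

  canonical : EdgeSet n → EdgeSet n → EdgeSet n
  canonical E L = filter (spanned? E L) allPairs

  canonical-solution : ∀ (E L : EdgeSet n) {B} → length L ≤ B → IsSolution E B (canonical E L)
  canonical-solution E L |L|≤B =
    unique ,
    All.tabulate (proj₁ ∘ proj₂ ∘ ∈-filter⁻ (spanned? E L) {xs = allPairs}) ,
    ≤-trans (unique-⊆⇒length≤ unique (proj₂ ∘ proj₂ ∘ ∈-filter⁻ (spanned? E L) {xs = allPairs})) |L|≤B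
    where
    unique : Unique (canonical E L)
    unique = filter⁺ (spanned? E L) allPairs-unique

  canonical-complete : ∀ (E L : EdgeSet n) → Edge (E ++ L) ⇒ Edge (E ++ canonical E L)
  canonical-complete E L {a} {b} e with (a , b) ∈? E | ∈-++⁻ E e
  ... | yes e∈E | _ = ∈-++⁺ˡ e∈E
  ... | no e∉E | inj₁ e∈E = ⊥-elim (e∉E e∈E)
  ... | no e∉E | inj₂ e∈L = ∈-++⁺ʳ E (∈-filter⁺ (spanned? E L) (∈-allPairs (a , b)) (e∉E , e∈L))

  solution? : ∀ (E : EdgeSet n) B N → Dec (IsSolution E B N)
  solution? E B N = unique? N ×-dec (all? (λ p → ¬? (p ∈? E)) N ×-dec (length N ≤? B))

  -- An optimal solution exists: maximise f over the canonical solutions,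
  -- which dominate all solutions and are finitely many.
  optimal-exists : ∀ (E : EdgeSet n) B → ∃[ N ] IsOptimal E B N
  optimal-exists E B = best , best-solution , value best , reachCount-correct (E ++ best) , dominates
    where
    candidates : List (EdgeSet n)
    candidates = filter (solution? E B) (sublists allPairs)

    value : EdgeSet n → ℕ
    value N = reachCount (E ++ N)

    best : EdgeSet n
    best = argmax value [] candidates

    best-solution : IsSolution E B best
    best-solution = argmax-all value (AllPairs.[] , All.[] , z≤n)
      (All.tabulate (proj₂ ∘ ∈-filter⁻ (solution? E B) {xs = sublists allPairs}))

    dominates : ∀ N' k' → IsSolution E B N' → HasReachCount (E ++ N') k' → k' ≤ value best
    dominates N' k' (_ , _ , |N'|≤B) count' =
      ≤-trans (count-mono count' (reachCount-correct (E ++ canonical E N'))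
                 (Star.map (canonical-complete E N')))
              (All.lookup (f[xs]≤f[argmax] {f = value} [] candidates)
                 (∈-filter⁺ (solution? E B) (filter∈sublists (spanned? E N') allPairs)
                    (canonical-solution E N' |N'|≤B)))

  optimal-unimprovable : ∀ {E N N' : EdgeSet n} {B} → IsOptimal E B N → IsSolution E B N' →
    Reach (E ++ N) ⇒ Reach (E ++ N') → ∀ {v u} →
    ¬ Reach (E ++ N) v u → Reach (E ++ N') v u → ⊥
  optimal-unimprovable {E} {N' = N'} (_ , k , count , maximal) solution' more ¬vu vu' =
    n≮n k (≤-trans (count-strict count (reachCount-correct (E ++ N')) more ¬vu vu')
                   (maximal N' _ solution' (reachCount-correct (E ++ N'))))

  merging-gains-pair : ∀ {G G' : EdgeSet n} {v u} → ¬ SameSCC G v u → SameSCC G' v u →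
    ∃[ a ] ∃[ b ] (¬ Reach G a b × Reach G' a b)
  merging-gains-pair {G} {v = v} {u} v≁u (v⇝u , u⇝v) with reach? G v u
  ... | yes vu = u , v , (λ uv → v≁u (vu , uv)) , u⇝v
  ... | no ¬vu = v , u , ¬vu , v⇝u

  module Exchange {E N : EdgeSet n} {v u x₁ y₁ x₂ y₂ : Fin n}
    (e₁∈N : (x₁ , y₁) ∈ N) (e₂∈N : (x₂ , y₂) ∈ N)
    (v~x₁ : SameSCC (E ++ N) v x₁) (v~y₁ : SameSCC (E ++ N) v y₁)
    (u~x₂ : SameSCC (E ++ N) u x₂) (u~y₂ : SameSCC (E ++ N) u y₂)
    (v≁u : ¬ SameSCC (E ++ N) v u) where

    G : EdgeSet n
    G = E ++ N

    e₁≢e₂ : (x₁ , y₁) ≢ (x₂ , y₂)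
    e₁≢e₂ refl = v≁u (scc-trans v~x₁ (scc-sym u~x₂))

    no-round-trip : ¬ (Reach G y₁ x₂ × Reach G y₂ x₁)
    no-round-trip (y₁⇝x₂ , y₂⇝x₁) =
      v≁u (proj₁ v~y₁ ◅◅ y₁⇝x₂ ◅◅ proj₂ u~x₂ , proj₁ u~y₂ ◅◅ y₂⇝x₁ ◅◅ proj₂ v~x₁)

    L : EdgeSet n
    L = (x₁ , y₂) ∷ (x₂ , y₁) ∷ remove (x₂ , y₂) (remove (x₁ , y₁) N)

    L-length : length L ≤ length N
    L-length = ≤-trans (s≤s (remove-shrinks (remove-keeps e₂∈N (e₁≢e₂ ∘ sym))))
                       (remove-shrinks e₁∈N)

    kept : ∀ {a b} → Edge G a b → (a , b) ≢ (x₁ , y₁) → (a , b) ≢ (x₂ , y₂) → Edge (E ++ L) a b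
    kept e ne₁ ne₂ with ∈-++⁻ E e
    ... | inj₁ e∈E = ∈-++⁺ˡ e∈E
    ... | inj₂ e∈N = ∈-++⁺ʳ E (there (there (remove-keeps (remove-keeps e∈N ne₁) ne₂)))

    y₁⇝x₁ : Reach (E ++ L) y₁ x₁
    y₁⇝x₁ = Star.map (λ { ((e , ne₁) , ne₂) → kept e ne₁ ne₂ })
      (closing-path x₁ y₁ x₂ y₂ (proj₂ v~y₁ ◅◅ proj₁ v~x₁) no-round-trip)

    y₂⇝x₂ : Reach (E ++ L) y₂ x₂
    y₂⇝x₂ = Star.map (λ { ((e , ne₂) , ne₁) → kept e ne₁ ne₂ })
      (closing-path x₂ y₂ x₁ y₁ (proj₂ u~y₂ ◅◅ proj₁ u~x₂) (no-round-trip ∘ swap))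

    x₁→y₂ : Edge (E ++ L) x₁ y₂
    x₁→y₂ = ∈-++⁺ʳ E (here refl)

    x₂→y₁ : Edge (E ++ L) x₂ y₁
    x₂→y₁ = ∈-++⁺ʳ E (there (here refl))

    x₁⇝x₂ : Reach (E ++ L) x₁ x₂
    x₁⇝x₂ = x₁→y₂ ◅ y₂⇝x₂

    x₂⇝x₁ : Reach (E ++ L) x₂ x₁
    x₂⇝x₁ = x₂→y₁ ◅ y₁⇝x₁

    simulate : Edge G ⇒ Reach (E ++ L)
    simulate {a} {b} e with (a , b) ≟ₚ (x₁ , y₁) | (a , b) ≟ₚ (x₂ , y₂)
    ... | yes refl | _        = x₁⇝x₂ ◅◅ x₂→y₁ ◅ ε
    ... | no _     | yes refl = x₂⇝x₁ ◅◅ x₁→y₂ ◅ ε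
    ... | no ne₁   | no ne₂   = kept e ne₁ ne₂ ◅ ε

    preserves : Reach G ⇒ Reach (E ++ L)
    preserves = simulate ⋆

    merges : SameSCC (E ++ L) v u
    merges = preserves (proj₁ v~x₁) ◅◅ x₁⇝x₂ ◅◅ preserves (proj₂ u~x₂) ,
             preserves (proj₁ u~x₂) ◅◅ x₂⇝x₁ ◅◅ preserves (proj₂ v~x₁)

    not-optimal : ∀ {B} → IsOptimal E B N → ⊥
    not-optimal {B} optimal with merging-gains-pair v≁u merges
    ... | a , b , ¬ab , ab' =
      optimal-unimprovable optimal solution' (spanned ∘ preserves) ¬ab (spanned ab')
      where
      solution' : IsSolution E B (canonical E L)
      solution' = canonical-solution E L (≤-trans L-length (proj₂ (proj₂ (proj₁ optimal))))
      spanned : Reach (E ++ L) ⇒ Reach (E ++ canonical E L)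
      spanned = Star.map (canonical-complete E L)

  sameSCC? : (G : EdgeSet n) → ∀ v u → Dec (SameSCC G v u)
  sameSCC? G v u = reach? G v u ×-dec reach? G u v

  optimal⇒atMostOneNontrivialSCC : ∀ {E N : EdgeSet n} {B} → IsDAG E → IsOptimal E B N →
    AtMostOneNontrivialSCC (E ++ N)
  optimal⇒atMostOneNontrivialSCC {E} {N} dag optimal v u v-nontrivial u-nontrivial
    with sameSCC? (E ++ N) v u
  ... | yes v~u = v~u
  ... | no v≁u
    with nontrivial-SCC-has-added-edge dag v-nontrivial
       | nontrivial-SCC-has-added-edge dag u-nontrivial
  ... | x₁ , y₁ , e₁∈N , v~x₁ , v~y₁ | x₂ , y₂ , e₂∈N , u~x₂ , u~y₂ =
    ⊥-elim (Exchange.not-optimal e₁∈N e₂∈N v~x₁ v~y₁ u~x₂ u~y₂ v≁u optimal)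

proposition3 : ∀ (n : ℕ) (E : EdgeSet n) (B : ℕ) → IsDAG E →
    ∃[ N ] (IsOptimal E B N × AtMostOneNontrivialSCC (addEdges E N))
proposition3 n E B dag with optimal-exists E B
... | N , optimal = N , optimal , optimal⇒atMostOneNontrivialSCC dag optimal
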